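{- Let $G$ be a graph with a list assignment $L$ (a set $L(x)$ of colors for each $x\in V(G)\cup E(G)$). Suppose $G$ contains a cycle $u_1u_2u_3u_4$ with $u_2u_4\in E(G)$, $d(u_2)=d(u_4)=3$, and $u_3$ adjacent to a vertex $v$. Let $\varphi'$ be a partial $L$-total coloring of $G$ whose uncolored elements are exactly $u_1u_2,u_2u_3,u_3u_4,u_1u_4,u_2u_4,u_3v,u_2,u_3,u_4$ and $v$. If $|L_{av}(u_2u_4,\varphi')|\geq 6$, $\min\{|L_{av}(u_2,\varphi')|,|L_{av}(u_4,\varphi')|\}\geq 5$, $\min\{|L_{av}(u_2u_3,\varphi')|,|L_{av}(u_3u_4,\varphi')|\}\geq 4$, $\min\{|L_{av}(u_1u_2,\varphi')|,|L_{av}(u_1u_4,\varphi')|,|L_{av}(u_3v,\varphi')|,|L_{av}(u_3,\varphi')|,|L_{av}(v,\varphi')|\}\geq 2$, and at least two of $L_{av}(u_3v,\varphi'),L_{av}(u_3,\varphi'),L_{av}(v,\varphi')$ are distinct whenever $|L_{av}(u_3v,\varphi')|=|L_{av}(u_3,\varphi')|=|L_{av}(v,\varphi')|=2$, then $\varphi'$ can be extended to an $L$-total coloring $\varphi$ of $G$ without altering the colors already assigned.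
   Context: A total coloring assigns colors to vertices and edges so that adjacent vertices, adjacent edges (sharing an endpoint), and a vertex and an incident edge receive different colors. An $L$-total coloring is a total coloring $\varphi$ with $\varphi(x)\in L(x)$ for every element $x$; a partial $L$-total coloring is such a coloring defined on a subset of the elements, proper among the colored elements. For an uncolored element $x$, the available list $L_{av}(x,\varphi')$ is the set of colors in $L(x)$ not used by $\varphi'$ on any colored element adjacent or incident to $x$. -}

module Defs where

open import Data.Nat using (ℕ; _≟_)
open import Data.Bool using (Bool; true; false; T; not; _∧_; if_then_else_)
open import Data.Fin using (Fin)
open import Data.Fin.Properties using () renaming (_≟_ to _≟ᶠ_)
open import Data.List using (List; []; _∷_; _++_; filter; length; concatMap; deduplicate; allFin)
open import Data.List.Membership.Propositional using (_∈_)
open import Data.List.Membership.DecPropositional _≟_ using (_∈?_)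
open import Data.Maybe using (Maybe; just; nothing)
open import Data.Product using (_×_; Σ)
open import Data.Sum using (_⊎_)
open import Data.Unit using (⊤)
open import Relation.Nullary using (¬_; ¬?; does)
open import Relation.Nullary.Decidable using (T?)
open import Relation.Binary.PropositionalEquality using (_≡_; _≢_)

Color : Set
Color = ℕ

-- Edges are unordered pairs {x,y}
-- with adj x y; edge-indexed data is given as a function of both endpoints
-- and required to be symmetric.
record Graph : Set where
  field
    n      : ℕ
    adj    : Fin n → Fin n → Bool
    sym    : ∀ x y → adj x y ≡ adj y x
    irrefl : ∀ x → adj x x ≡ false
open Graph public

Adj : (G : Graph) → Fin (n G) → Fin (n G) → Set
Adj G x y = T (adj G x y)

deg : (G : Graph) → Fin (n G) → ℕ
deg G u = length (filter (λ y → T? (adj G u y)) (allFin (n G)))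

card : List Color → ℕ
card xs = length (deduplicate _≟_ xs)

SameSet : List Color → List Color → Set
SameSet A B = ∀ c → (c ∈ A → c ∈ B) × (c ∈ B → c ∈ A)

_⇔'_ : Set → Set → Set
A ⇔' B = (A → B) × (B → A)

record ListAssignment (G : Graph) : Set where
  field
    Lv    : Fin (n G) → List Color
    Le    : Fin (n G) → Fin (n G) → List Color
    Le-sym : ∀ x y → Le x y ≡ Le y x
open ListAssignment public

-- a partial total coloring: nothing = uncolored.  Values of pe on
-- non-adjacent pairs are irrelevant.
record PartialColoring (G : Graph) : Set where
  field
    pv     : Fin (n G) → Maybe Color
    pe     : Fin (n G) → Fin (n G) → Maybe Color
    pe-sym : ∀ x y → pe x y ≡ pe y x
open PartialColoring public

Differ : Maybe Color → Maybe Color → Set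
Differ (just a) (just b) = a ≢ b
Differ _ _ = ⊤

InList : Maybe Color → List Color → Set
InList (just c) L = c ∈ L
InList nothing L = ⊤

IsPartialLTotal : (G : Graph) → ListAssignment G → PartialColoring G → Set
IsPartialLTotal G L φ =
  (∀ x → InList (pv φ x) (Lv L x)) ×
  (∀ x y → Adj G x y → InList (pe φ x y) (Le L x y)) ×
  (∀ x y → Adj G x y → Differ (pv φ x) (pv φ y)) ×
  (∀ x y → Adj G x y → Differ (pv φ x) (pe φ x y)) ×
  (∀ x y z → Adj G x y → Adj G x z → y ≢ z → Differ (pe φ x y) (pe φ x z))

record TotalColoring (G : Graph) : Set where
  field
    cv     : Fin (n G) → Color
    ce     : Fin (n G) → Fin (n G) → Color
    ce-sym : ∀ x y → ce x y ≡ ce y x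
open TotalColoring public

IsLTotal : (G : Graph) → ListAssignment G → TotalColoring G → Set
IsLTotal G L φ =
  (∀ x → cv φ x ∈ Lv L x) ×
  (∀ x y → Adj G x y → ce φ x y ∈ Le L x y) ×
  (∀ x y → Adj G x y → cv φ x ≢ cv φ y) ×
  (∀ x y → Adj G x y → cv φ x ≢ ce φ x y) ×
  (∀ x y z → Adj G x y → Adj G x z → y ≢ z → ce φ x y ≢ ce φ x z)

Extends : (G : Graph) → TotalColoring G → PartialColoring G → Set
Extends G φ φ' =
  (∀ x c → pv φ' x ≡ just c → cv φ x ≡ c) ×
  (∀ x y c → Adj G x y → pe φ' x y ≡ just c → ce φ x y ≡ c)

toL : Maybe Color → List Color
toL (just c) = c ∷ []
toL nothing = []

forbV : (G : Graph) → PartialColoring G → Fin (n G) → List Color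
forbV G φ x = concatMap
  (λ y → if adj G x y then toL (pv φ y) ++ toL (pe φ x y) else [])
  (allFin (n G))

forbE : (G : Graph) → PartialColoring G → Fin (n G) → Fin (n G) → List Color
forbE G φ x y =
  toL (pv φ x) ++ toL (pv φ y) ++
  concatMap (λ z → if adj G x z ∧ not (does (z ≟ᶠ y)) then toL (pe φ x z) else []) (allFin (n G)) ++
  concatMap (λ z → if adj G y z ∧ not (does (z ≟ᶠ x)) then toL (pe φ y z) else []) (allFin (n G))

LavV : (G : Graph) → ListAssignment G → PartialColoring G → Fin (n G) → List Color
LavV G L φ x = filter (λ c → ¬? (c ∈? forbV G φ x)) (Lv L x)

LavE : (G : Graph) → ListAssignment G → PartialColoring G → Fin (n G) → Fin (n G) → List Color
LavE G L φ x y = filter (λ c → ¬? (c ∈? forbE G φ x y)) (Le L x y)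

SameEdge : {m : ℕ} → Fin m → Fin m → Fin m → Fin m → Set
SameEdge x y a b = (x ≡ a × y ≡ b) ⊎ (x ≡ b × y ≡ a)

-- The ten uncoloured elements split into the triangle u₃, u₃v, v and the graph H formed by u₂, u₄,
-- the 4-cycle u₁u₂u₃u₄ and its chord u₂u₄; v is adjacent to neither u₂ nor u₄ since both have degree 3.
-- Colouring the triangle first, with a at u₃ and b at u₃v, removes a from the lists of u₂, u₄ and a, b
-- from those of u₂u₃, u₃u₄, leaving H lists of sizes at least 6 (u₂u₄), 4 (u₂, u₄) and 2 (cycle edges).
-- A case analysis colours H from such lists unless they form a tight obstruction, which forces
-- a ∈ L(u₂) ∖ L(u₂u₄) and L(u₂u₃) ∖ {a, b} ⊆ L(u₁u₂) with |L(u₁u₂)| ≤ 2. The hypothesis on the three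
-- 2-lists of the triangle gives two triangle colourings that differ at u₃ or at u₃v, and the
-- obstruction cannot occur for both.

module Submission where

open import Defs hiding (sym)
open import Data.Nat using (ℕ; suc; _+_; _≤_; _≥_; z≤n; s≤s; _≟_; _<?_; _≤?_)
open import Data.Nat.Properties using (<-irrefl; <-≤-trans; ≤-trans; ≤-refl; <⇒≱; ≤-antisym; ≤-pred; ≰⇒>; +-mono-≤; +-monoʳ-≤; +-cancelʳ-≤; +-comm)
open import Data.Bool using (T; not; _∧_; if_then_else_)
open import Data.Bool.Properties using (T-≡)
open import Data.Fin using (Fin)
open import Data.Fin.Properties using () renaming (_≟_ to _≟ᶠ_)
open import Data.List using (List; []; _∷_; _++_; filter; length; deduplicate; concatMap; allFin)
open import Data.List.Properties using (length-filter; filter-notAll; filter-all; length-++)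
open import Data.List.Membership.Propositional using (_∈_; _∉_; find; lose)
open import Data.List.Membership.Propositional.Properties using (∈-filter⁺; ∈-filter⁻; ∈-deduplicate⁺; ∈-deduplicate⁻; ∈-++⁺ˡ; ∈-++⁺ʳ; ∈-++⁻; ∈-allFin; ∈-concatMap⁺)
open import Data.List.Membership.DecPropositional _≟_ using (_∈?_; _∉?_)
open import Data.List.Relation.Unary.Any as Any using (Any; here; there; any?)
open import Data.List.Relation.Unary.All as All using (All; []; _∷_)
open import Data.List.Relation.Unary.All.Properties using (¬Any⇒All¬; All¬⇒¬Any)
open import Data.List.Relation.Unary.Unique.Propositional using (Unique; []; _∷_)
open import Data.List.Relation.Unary.Unique.DecPropositional.Properties _≟_ using (deduplicate-!; ++⁺)
open import Data.List.Relation.Binary.Subset.Propositional using (_⊆_)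
open import Data.List.Relation.Binary.Subset.Propositional.Properties using (∈-∷⁺ʳ)
open import Data.List.Relation.Binary.Disjoint.Propositional using (Disjoint)
open import Data.List.Relation.Binary.Disjoint.Propositional.Properties using () renaming (sym to Disjoint-sym)
open import Data.Maybe using (Maybe; just; nothing; maybe)
open import Data.Maybe.Properties using (just-injective)
open import Data.Product using (Σ; ∃-syntax; Σ-syntax; _×_; _,_; proj₁; proj₂; uncurry)
open import Data.Sum using (_⊎_; inj₁; inj₂)
open import Data.Empty using (⊥; ⊥-elim)
open import Function using (_∘_; Equivalence)
open import Relation.Nullary using (¬_; Dec; yes; no; ¬?; does)
open import Relation.Nullary.Decidable using (True; T?; toWitness; decidable-stable; dec-true; dec-false)
open import Relation.Binary.Definitions using (DecidableEquality)
open import Relation.Binary.PropositionalEquality using (_≡_; _≢_; refl; sym; trans; subst; cong; cong₂; ≢-sym)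

Unique-⊆⇒length≤ : {A : Set} → DecidableEquality A → {xs ys : List A} →
  Unique xs → xs ⊆ ys → length xs ≤ length ys
Unique-⊆⇒length≤ _≟ᴬ_ {[]} _ _ = z≤n
Unique-⊆⇒length≤ {A} _≟ᴬ_ {x ∷ xs} {ys} (x∉xs ∷ xs!) x∷xs⊆ys =
  <-≤-trans (s≤s (Unique-⊆⇒length≤ _≟ᴬ_ xs! xs⊆ys-x)) (filter-notAll ≢x? ys x∈ys)
  where
  ≢x? : (y : A) → Dec (x ≢ y)
  ≢x? y = ¬? (x ≟ᴬ y)
  x∈ys : Any (λ y → ¬ (x ≢ y)) ys
  x∈ys = Any.map (λ x≡y x≢y → x≢y x≡y) (x∷xs⊆ys (here refl))
  xs⊆ys-x : xs ⊆ filter ≢x? ys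
  xs⊆ys-x c∈xs = ∈-filter⁺ ≢x? (x∷xs⊆ys (there c∈xs)) (All.lookup x∉xs c∈xs)

Unique-⊆⇒length≤card : {xs ys : List Color} → Unique xs → xs ⊆ ys → length xs ≤ card ys
Unique-⊆⇒length≤card xs! xs⊆ys = Unique-⊆⇒length≤ _≟_ xs! (∈-deduplicate⁺ _≟_ ∘ xs⊆ys)

card-mono : {A B : List Color} → A ⊆ B → card A ≤ card B
card-mono {A} A⊆B = Unique-⊆⇒length≤card (deduplicate-! A) (A⊆B ∘ ∈-deduplicate⁻ _≟_ A)

card≤length : (A : List Color) → card A ≤ length A
card≤length A = Unique-⊆⇒length≤ _≟_ (deduplicate-! A) (∈-deduplicate⁻ _≟_ A)

card-∷ : (c : Color) (A : List Color) → card (c ∷ A) ≤ suc (card A)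
card-∷ c A = s≤s (length-filter _ (deduplicate _≟_ A))

card-∷-∉ : {c : Color} {A : List Color} → c ∉ A → card (c ∷ A) ≡ suc (card A)
card-∷-∉ {c} {A} c∉A = cong (suc ∘ length) (filter-all _ (All.tabulate c≢))
  where
  c≢ : {d : Color} → d ∈ deduplicate _≟_ A → c ≢ d
  c≢ d∈ refl = c∉A (∈-deduplicate⁻ _≟_ A d∈)

card-++ : (F B : List Color) → card (F ++ B) ≤ length F + card B
card-++ [] B = ≤-refl
card-++ (f ∷ F) B = ≤-trans (card-∷ f (F ++ B)) (s≤s (card-++ F B))

card-disjoint : {A B M : List Color} → Disjoint A B → A ⊆ M → B ⊆ M → card A + card B ≤ card M
card-disjoint {A} {B} {M} A#B A⊆M B⊆M = subst (_≤ card M) (length-++ (deduplicate _≟_ A))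
  (Unique-⊆⇒length≤card (++⁺ (deduplicate-! A) (deduplicate-! B) A′#B′) A′++B′⊆M)
  where
  A′#B′ : Disjoint (deduplicate _≟_ A) (deduplicate _≟_ B)
  A′#B′ (c∈A′ , c∈B′) = A#B (∈-deduplicate⁻ _≟_ A c∈A′ , ∈-deduplicate⁻ _≟_ B c∈B′)
  A′++B′⊆M : deduplicate _≟_ A ++ deduplicate _≟_ B ⊆ M
  A′++B′⊆M c∈ with ∈-++⁻ (deduplicate _≟_ A) c∈
  ... | inj₁ c∈A′ = A⊆M (∈-deduplicate⁻ _≟_ A c∈A′)
  ... | inj₂ c∈B′ = B⊆M (∈-deduplicate⁻ _≟_ B c∈B′)

card-∷-disjoint : {c : Color} {A B M : List Color} → c ∉ A → c ∉ B → c ∈ M →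
  Disjoint A B → A ⊆ M → B ⊆ M → suc (card A + card B) ≤ card M
card-∷-disjoint {c} {A} {B} {M} c∉A c∉B c∈M A#B A⊆M B⊆M =
  subst (λ k → k + card B ≤ card M) (card-∷-∉ c∉A) (card-disjoint c∷A#B (∈-∷⁺ʳ c∈M A⊆M) B⊆M)
  where
  c∷A#B : Disjoint (c ∷ A) B
  c∷A#B (here refl , c∈B) = c∉B c∈B
  c∷A#B (there d∈A , d∈B) = A#B (d∈A , d∈B)

Disjoint⇒∉⊎∉ : {A B : List Color} (γ : Color) → Disjoint A B → γ ∉ A ⊎ γ ∉ B
Disjoint⇒∉⊎∉ {A} γ A#B with γ ∈? A
... | yes γ∈A = inj₂ λ γ∈B → A#B (γ∈A , γ∈B)
... | no γ∉A = inj₁ γ∉A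

∃∉⊎⊆ : (A B : List Color) → (∃[ c ] c ∈ A × c ∉ B) ⊎ A ⊆ B
∃∉⊎⊆ A B with any? (_∉? B) A
... | yes ∃∉B = inj₁ (find ∃∉B)
... | no ∄∉B = inj₂ λ {c} c∈A → decidable-stable (c ∈? B) λ c∉B → ∄∉B (Any.map (λ { refl → c∉B }) c∈A)

∃∈⊎Disjoint : (A B : List Color) → (∃[ c ] c ∈ A × c ∈ B) ⊎ Disjoint A B
∃∈⊎Disjoint A B with any? (_∈? B) A
... | yes ∃∈B = inj₁ (find ∃∈B)
... | no ∄∈B = inj₂ λ (c∈A , c∈B) → ∄∈B (Any.map (λ { refl → c∈B }) c∈A)

avoid : {k : ℕ} (A F : List Color) → k ≤ card A → {True (length F <? k)} →
  ∃[ c ] c ∈ A × All (c ≢_) F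
avoid A F k≤∣A∣ {∣F∣<k} with ∃∉⊎⊆ A F
... | inj₁ (c , c∈A , c∉F) = c , c∈A , ¬Any⇒All¬ F c∉F
... | inj₂ A⊆F = ⊥-elim (<⇒≱ (<-≤-trans (toWitness ∣F∣<k) k≤∣A∣) (≤-trans (card-mono A⊆F) (card≤length F)))

∈∉⇒≢ : {a γ : Color} {A : List Color} → a ∈ A → γ ∉ A → a ≢ γ
∈∉⇒≢ a∈A γ∉A refl = γ∉A a∈A

_∖_ : List Color → List Color → List Color
A ∖ F = filter (_∉? F) A

∈-∖⁺ : {c : Color} {A F : List Color} → c ∈ A → c ∉ F → c ∈ A ∖ F
∈-∖⁺ {F = F} = ∈-filter⁺ (_∉? F)

∈-∖⁻ : {c : Color} (A F : List Color) → c ∈ A ∖ F → c ∈ A × c ∉ F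
∈-∖⁻ A F = ∈-filter⁻ (_∉? F) {xs = A}

card-∖ : (A F : List Color) → card A ≤ length F + card (A ∖ F)
card-∖ A F = ≤-trans (card-mono A⊆F++A∖F) (card-++ F (A ∖ F))
  where
  A⊆F++A∖F : A ⊆ F ++ A ∖ F
  A⊆F++A∖F {c} c∈A with c ∈? F
  ... | yes c∈F = ∈-++⁺ˡ c∈F
  ... | no c∉F = ∈-++⁺ʳ F (∈-∖⁺ c∈A c∉F)

record PathColouring (γ : Color) (A B C : List Color) : Set where
  constructor path
  field
    {a b c} : Color
    a∈ : a ∈ A
    b∈ : b ∈ B
    c∈ : c ∈ C
    a≢b : a ≢ b
    b≢c : b ≢ c
    a≢γ : a ≢ γ
    c≢γ : c ≢ γ

path-avoiding : {A B C : List Color} (γ : Color) → 2 ≤ card A → 2 ≤ card B → 2 ≤ card C →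
  γ ∉ A ⊎ γ ∉ C → PathColouring γ A B C
path-avoiding {A} {B} {C} γ kA kB kC (inj₁ γ∉A)
  with c , c∈ , c≢γ ∷ [] ← avoid C (γ ∷ []) kC
  with b , b∈ , b≢c ∷ [] ← avoid B (c ∷ []) kB
  with a , a∈ , a≢b ∷ [] ← avoid A (b ∷ []) kA
  = path a∈ b∈ c∈ a≢b b≢c (∈∉⇒≢ a∈ γ∉A) c≢γ
path-avoiding {A} {B} {C} γ kA kB kC (inj₂ γ∉C)
  with a , a∈ , a≢γ ∷ [] ← avoid A (γ ∷ []) kA
  with b , b∈ , b≢a ∷ [] ← avoid B (a ∷ []) kB
  with c , c∈ , c≢b ∷ [] ← avoid C (b ∷ []) kC
  = path a∈ b∈ c∈ (≢-sym b≢a) (≢-sym c≢b) a≢γ (∈∉⇒≢ c∈ γ∉C)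

record CycleColouring (E₁ E₂ E₃ E₄ : List Color) : Set where
  constructor cycle
  field
    {e₁ e₂ e₃ e₄} : Color
    e₁∈ : e₁ ∈ E₁
    e₂∈ : e₂ ∈ E₂
    e₃∈ : e₃ ∈ E₃
    e₄∈ : e₄ ∈ E₄
    e₁≢e₂ : e₁ ≢ e₂
    e₂≢e₃ : e₂ ≢ e₃
    e₃≢e₄ : e₃ ≢ e₄
    e₄≢e₁ : e₄ ≢ e₁
open CycleColouring using (e₁; e₂; e₃; e₄)

module _ {E₁ E₂ E₃ E₄ : List Color} where

  rotate : CycleColouring E₂ E₃ E₄ E₁ → CycleColouring E₁ E₂ E₃ E₄
  rotate (cycle ∈₂ ∈₃ ∈₄ ∈₁ ≢₂₃ ≢₃₄ ≢₄₁ ≢₁₂) = cycle ∈₁ ∈₂ ∈₃ ∈₄ ≢₁₂ ≢₂₃ ≢₃₄ ≢₄₁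

  swap₂₄ : CycleColouring E₄ E₃ E₂ E₁ → CycleColouring E₁ E₂ E₃ E₄
  swap₂₄ (cycle ∈₄ ∈₃ ∈₂ ∈₁ ≢₄₃ ≢₃₂ ≢₂₁ ≢₁₄) =
    cycle ∈₁ ∈₂ ∈₃ ∈₄ (≢-sym ≢₂₁) (≢-sym ≢₃₂) (≢-sym ≢₄₃) (≢-sym ≢₁₄)

  swap₁₃ : CycleColouring E₂ E₁ E₄ E₃ → CycleColouring E₁ E₂ E₃ E₄
  swap₁₃ (cycle ∈₂ ∈₁ ∈₄ ∈₃ ≢₂₁ ≢₁₄ ≢₄₃ ≢₃₂) =
    cycle ∈₁ ∈₂ ∈₃ ∈₄ (≢-sym ≢₂₁) (≢-sym ≢₃₂) (≢-sym ≢₄₃) (≢-sym ≢₁₄)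

  through : {γ : Color} → γ ∈ E₁ → PathColouring γ E₂ E₃ E₄ → CycleColouring E₁ E₂ E₃ E₄
  through γ∈ (path a∈ b∈ c∈ a≢b b≢c a≢γ c≢γ) = cycle γ∈ a∈ b∈ c∈ (≢-sym a≢γ) a≢b b≢c c≢γ

cycle-colourable : {E₁ E₂ E₃ E₄ : List Color} →
  2 ≤ card E₁ → 2 ≤ card E₂ → 2 ≤ card E₃ → 2 ≤ card E₄ → CycleColouring E₁ E₂ E₃ E₄
cycle-colourable {E₁} {E₂} {E₃} {E₄} k₁ k₂ k₃ k₄ with ∃∉⊎⊆ E₁ E₂
... | inj₁ (γ , γ∈ , γ∉) = through γ∈ (path-avoiding γ k₂ k₃ k₄ (inj₁ γ∉))
... | inj₂ E₁⊆E₂ with ∃∉⊎⊆ E₂ E₃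
... | inj₁ (γ , γ∈ , γ∉) = rotate (through γ∈ (path-avoiding γ k₃ k₄ k₁ (inj₁ γ∉)))
... | inj₂ E₂⊆E₃ with ∃∉⊎⊆ E₃ E₄
... | inj₁ (γ , γ∈ , γ∉) = rotate (rotate (through γ∈ (path-avoiding γ k₄ k₁ k₂ (inj₁ γ∉))))
... | inj₂ E₃⊆E₄ with ∃∉⊎⊆ E₄ E₁
... | inj₁ (γ , γ∈ , γ∉) = rotate (rotate (rotate (through γ∈ (path-avoiding γ k₁ k₂ k₃ (inj₁ γ∉)))))
... | inj₂ E₄⊆E₁
  with p , p∈ , _ ← avoid E₁ [] k₁
  with q , q∈ , q≢p ∷ [] ← avoid E₁ (p ∷ []) k₁
  = cycle p∈ (E₁⊆E₂ q∈) (E₂⊆E₃ (E₁⊆E₂ p∈)) (E₃⊆E₄ (E₂⊆E₃ (E₁⊆E₂ q∈))) (≢-sym q≢p) q≢p (≢-sym q≢p) q≢p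

record TriangleColouring (A₁ A₂ A₃ : List Color) : Set where
  constructor triangle
  field
    {c₁ c₂ c₃} : Color
    c₁∈ : c₁ ∈ A₁
    c₂∈ : c₂ ∈ A₂
    c₃∈ : c₃ ∈ A₃
    c₁≢c₂ : c₁ ≢ c₂
    c₁≢c₃ : c₁ ≢ c₃
    c₂≢c₃ : c₂ ≢ c₃
open TriangleColouring using (c₁; c₂; c₃)

module _ {A₁ A₂ A₃ : List Color} where

  swap₁₂ : TriangleColouring A₂ A₁ A₃ → TriangleColouring A₁ A₂ A₃
  swap₁₂ (triangle ∈₂ ∈₁ ∈₃ ≢₂₁ ≢₂₃ ≢₁₃) = triangle ∈₁ ∈₂ ∈₃ (≢-sym ≢₂₁) ≢₁₃ ≢₂₃

  swap₂₃ : TriangleColouring A₁ A₃ A₂ → TriangleColouring A₁ A₂ A₃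
  swap₂₃ (triangle ∈₁ ∈₃ ∈₂ ≢₁₃ ≢₁₂ ≢₃₂) = triangle ∈₁ ∈₂ ∈₃ ≢₁₂ ≢₁₃ (≢-sym ≢₃₂)

  rotate₃ : TriangleColouring A₂ A₃ A₁ → TriangleColouring A₁ A₂ A₃
  rotate₃ (triangle ∈₂ ∈₃ ∈₁ ≢₂₃ ≢₂₁ ≢₃₁) = triangle ∈₁ ∈₂ ∈₃ (≢-sym ≢₂₁) (≢-sym ≢₃₁) ≢₂₃

Varying₁ : List Color → List Color → List Color → Set
Varying₁ A₁ A₂ A₃ = Σ[ s ∈ TriangleColouring A₁ A₂ A₃ ] Σ[ s′ ∈ TriangleColouring A₁ A₂ A₃ ] c₁ s ≢ c₁ s′

Varying₁₂ : List Color → List Color → List Color → Set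
Varying₁₂ A₁ A₂ A₃ = Σ[ s ∈ TriangleColouring A₁ A₂ A₃ ] Σ[ s′ ∈ TriangleColouring A₁ A₂ A₃ ]
  (c₁ s ≢ c₁ s′ ⊎ c₂ s ≢ c₂ s′)

module _ {A₁ A₂ A₃ : List Color} where

  varying₁-large₃ : 2 ≤ card A₁ → 2 ≤ card A₂ → 3 ≤ card A₃ → Varying₁ A₁ A₂ A₃
  varying₁-large₃ k₁ k₂ k₃
    with x , x∈ , _ ← avoid A₁ [] k₁
    with x′ , x′∈ , x′≢x ∷ [] ← avoid A₁ (x ∷ []) k₁
    with y , y∈ , y≢x ∷ [] ← avoid A₂ (x ∷ []) k₂
    with y′ , y′∈ , y′≢x′ ∷ [] ← avoid A₂ (x′ ∷ []) k₂
    with z , z∈ , z≢x ∷ z≢y ∷ [] ← avoid A₃ (x ∷ y ∷ []) k₃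
    with z′ , z′∈ , z′≢x′ ∷ z′≢y′ ∷ [] ← avoid A₃ (x′ ∷ y′ ∷ []) k₃
    = triangle x∈ y∈ z∈ (≢-sym y≢x) (≢-sym z≢x) (≢-sym z≢y)
    , triangle x′∈ y′∈ z′∈ (≢-sym y′≢x′) (≢-sym z′≢x′) (≢-sym z′≢y′)
    , ≢-sym x′≢x

  varying₁-shared₁₃ : 2 ≤ card A₁ → 2 ≤ card A₂ → 2 ≤ card A₃ →
    {γ : Color} → γ ∈ A₁ → γ ∉ A₂ → γ ∈ A₃ → Varying₁ A₁ A₂ A₃
  varying₁-shared₁₃ k₁ k₂ k₃ {γ} γ∈A₁ γ∉A₂ γ∈A₃
    with z , z∈ , z≢γ ∷ [] ← avoid A₃ (γ ∷ []) k₃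
    with y , y∈ , y≢z ∷ [] ← avoid A₂ (z ∷ []) k₂
    with x′ , x′∈ , x′≢γ ∷ [] ← avoid A₁ (γ ∷ []) k₁
    with y′ , y′∈ , y′≢x′ ∷ [] ← avoid A₂ (x′ ∷ []) k₂
    = triangle γ∈A₁ y∈ z∈ (≢-sym (∈∉⇒≢ y∈ γ∉A₂)) (≢-sym z≢γ) y≢z
    , triangle x′∈ y′∈ γ∈A₃ (≢-sym y′≢x′) x′≢γ (∈∉⇒≢ y′∈ γ∉A₂)
    , ≢-sym x′≢γ

  varying₁-private₂ : 2 ≤ card A₁ → 2 ≤ card A₃ →
    {γ : Color} → γ ∉ A₁ → γ ∈ A₂ → γ ∉ A₃ → Varying₁ A₁ A₂ A₃
  varying₁-private₂ k₁ k₃ {γ} γ∉A₁ γ∈A₂ γ∉A₃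
    with x , x∈ , _ ← avoid A₁ [] k₁
    with x′ , x′∈ , x′≢x ∷ [] ← avoid A₁ (x ∷ []) k₁
    with z , z∈ , z≢x ∷ [] ← avoid A₃ (x ∷ []) k₃
    with z′ , z′∈ , z′≢x′ ∷ [] ← avoid A₃ (x′ ∷ []) k₃
    = triangle x∈ γ∈A₂ z∈ (∈∉⇒≢ x∈ γ∉A₁) (≢-sym z≢x) (≢-sym (∈∉⇒≢ z∈ γ∉A₃))
    , triangle x′∈ γ∈A₂ z′∈ (∈∉⇒≢ x′∈ γ∉A₁) (≢-sym z′≢x′) (≢-sym (∈∉⇒≢ z′∈ γ∉A₃))
    , ≢-sym x′≢x

varying₁₂-swap : {A₁ A₂ A₃ : List Color} → Varying₁₂ A₂ A₁ A₃ → Varying₁₂ A₁ A₂ A₃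
varying₁₂-swap (s , s′ , inj₁ ≢₂) = swap₁₂ s , swap₁₂ s′ , inj₂ ≢₂
varying₁₂-swap (s , s′ , inj₂ ≢₁) = swap₁₂ s , swap₁₂ s′ , inj₁ ≢₁

varying₁₂-difference : {A₁ A₂ A₃ : List Color} {γ : Color} →
  2 ≤ card A₁ → 2 ≤ card A₂ → 2 ≤ card A₃ → γ ∈ A₁ → γ ∉ A₂ → Varying₁₂ A₁ A₂ A₃
varying₁₂-difference {A₃ = A₃} {γ} k₁ k₂ k₃ γ∈A₁ γ∉A₂ with γ ∈? A₃
... | yes γ∈A₃ = let (s , s′ , ≢₁) = varying₁-shared₁₃ k₁ k₂ k₃ γ∈A₁ γ∉A₂ γ∈A₃ in s , s′ , inj₁ ≢₁
... | no γ∉A₃ = let (s , s′ , ≢₂) = varying₁-private₂ k₂ k₃ γ∉A₂ γ∈A₁ γ∉A₃ in swap₁₂ s , swap₁₂ s′ , inj₂ ≢₂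

exactly-2 : {k : ℕ} → 2 ≤ k → ¬ 3 ≤ k → k ≡ 2
exactly-2 2≤k 3≰k = ≤-antisym (≤-pred (≰⇒> 3≰k)) 2≤k

triangle-varying₁₂ : {A₁ A₂ A₃ : List Color} →
  2 ≤ card A₁ → 2 ≤ card A₂ → 2 ≤ card A₃ →
  (card A₁ ≡ 2 → card A₂ ≡ 2 → card A₃ ≡ 2 → ¬ (SameSet A₁ A₂ × SameSet A₂ A₃)) →
  Varying₁₂ A₁ A₂ A₃
triangle-varying₁₂ {A₁} {A₂} {A₃} k₁ k₂ k₃ not-all-equal with 3 ≤? card A₃
... | yes k₃′ = let (s , s′ , ≢₁) = varying₁-large₃ k₁ k₂ k₃′ in s , s′ , inj₁ ≢₁
... | no k₃≢ with 3 ≤? card A₂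
... | yes k₂′ = let (s , s′ , ≢₁) = varying₁-large₃ k₁ k₃ k₂′ in swap₂₃ s , swap₂₃ s′ , inj₁ ≢₁
... | no k₂≢ with 3 ≤? card A₁
... | yes k₁′ = let (s , s′ , ≢₂) = varying₁-large₃ k₂ k₃ k₁′ in rotate₃ s , rotate₃ s′ , inj₂ ≢₂
... | no k₁≢ with ∃∉⊎⊆ A₁ A₂
... | inj₁ (γ , γ∈A₁ , γ∉A₂) = varying₁₂-difference k₁ k₂ k₃ γ∈A₁ γ∉A₂
... | inj₂ A₁⊆A₂ with ∃∉⊎⊆ A₂ A₁
... | inj₁ (γ , γ∈A₂ , γ∉A₁) = varying₁₂-swap (varying₁₂-difference k₂ k₁ k₃ γ∈A₂ γ∉A₁)
... | inj₂ A₂⊆A₁ with ∃∉⊎⊆ A₂ A₃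
... | inj₁ (γ , γ∈A₂ , γ∉A₃) =
  let (s , s′ , ≢₂) = varying₁-shared₁₃ k₂ k₃ k₁ γ∈A₂ γ∉A₃ (A₂⊆A₁ γ∈A₂) in rotate₃ s , rotate₃ s′ , inj₂ ≢₂
... | inj₂ A₂⊆A₃ with ∃∉⊎⊆ A₃ A₂
... | inj₁ (γ , γ∈A₃ , γ∉A₂) =
  let (s , s′ , ≢₁) = varying₁-private₂ k₁ k₂ (γ∉A₂ ∘ A₁⊆A₂) γ∈A₃ γ∉A₂ in swap₂₃ s , swap₂₃ s′ , inj₁ ≢₁
... | inj₂ A₃⊆A₂ = ⊥-elim (not-all-equal (exactly-2 k₁ k₁≢) (exactly-2 k₂ k₂≢) (exactly-2 k₃ k₃≢)
  ((λ _ → A₁⊆A₂ , A₂⊆A₁) , (λ _ → A₂⊆A₃ , A₃⊆A₂)))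

-- The lists M, X, Y, E₁, E₂, E₃, E₄ are those of u₂u₄, u₂, u₄, u₁u₂, u₂u₃, u₃u₄, u₄u₁.
record HColouring (M X Y E₁ E₂ E₃ E₄ : List Color) : Set where
  constructor hColouring
  field
    cyc : CycleColouring E₁ E₂ E₃ E₄
    {x y m} : Color
    x∈ : x ∈ X
    y∈ : y ∈ Y
    m∈ : m ∈ M
    x≢e₁ : x ≢ e₁ cyc
    x≢e₂ : x ≢ e₂ cyc
    y≢e₃ : y ≢ e₃ cyc
    y≢e₄ : y ≢ e₄ cyc
    y≢x : y ≢ x
    m≢e₁ : m ≢ e₁ cyc
    m≢e₂ : m ≢ e₂ cyc
    m≢e₃ : m ≢ e₃ cyc
    m≢e₄ : m ≢ e₄ cyc
    m≢x : m ≢ x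
    m≢y : m ≢ y

record HBounds (M X Y E₁ E₂ E₃ E₄ : List Color) : Set where
  constructor hBounds
  field
    kM : 6 ≤ card M
    kX : 4 ≤ card X
    kY : 4 ≤ card Y
    k₁ : 2 ≤ card E₁
    k₂ : 2 ≤ card E₂
    k₃ : 2 ≤ card E₃
    k₄ : 2 ≤ card E₄

record Obstruction (M X Y E₁ E₂ E₃ E₄ : List Color) : Set where
  field
    M⊆X∪E₃ : {c : Color} → c ∈ M → c ∈ X ⊎ c ∈ E₃
    X⊆M : X ⊆ M
    E₂⊆E₁ : E₂ ⊆ E₁
    ∣E₁∣≤2 : card E₁ ≤ 2
    ∣X∣≤4 : card X ≤ 4

module _ {M X Y E₁ E₂ E₃ E₄ : List Color} where

  hColouring-swap₂₄ : HColouring M Y X E₄ E₃ E₂ E₁ → HColouring M X Y E₁ E₂ E₃ E₄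
  hColouring-swap₂₄ (hColouring c y∈ x∈ m∈ y≢e₄ y≢e₃ x≢e₂ x≢e₁ x≢y m≢e₄ m≢e₃ m≢e₂ m≢e₁ m≢y m≢x) =
    hColouring (swap₂₄ c) x∈ y∈ m∈ x≢e₁ x≢e₂ y≢e₃ y≢e₄ (≢-sym x≢y) m≢e₁ m≢e₂ m≢e₃ m≢e₄ m≢x m≢y

  hColouring-swap₁₃ : HColouring M X Y E₂ E₁ E₄ E₃ → HColouring M X Y E₁ E₂ E₃ E₄
  hColouring-swap₁₃ (hColouring c x∈ y∈ m∈ x≢e₂ x≢e₁ y≢e₄ y≢e₃ y≢x m≢e₂ m≢e₁ m≢e₄ m≢e₃ m≢x m≢y) =
    hColouring (swap₁₃ c) x∈ y∈ m∈ x≢e₁ x≢e₂ y≢e₃ y≢e₄ y≢x m≢e₁ m≢e₂ m≢e₃ m≢e₄ m≢x m≢y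

  hBounds-swap₂₄ : HBounds M X Y E₁ E₂ E₃ E₄ → HBounds M Y X E₄ E₃ E₂ E₁
  hBounds-swap₂₄ (hBounds kM kX kY k₁ k₂ k₃ k₄) = hBounds kM kY kX k₄ k₃ k₂ k₁

  hBounds-swap₁₃ : HBounds M X Y E₁ E₂ E₃ E₄ → HBounds M X Y E₂ E₁ E₄ E₃
  hBounds-swap₁₃ (hBounds kM kX kY k₁ k₂ k₃ k₄) = hBounds kM kX kY k₂ k₁ k₄ k₃

module _ {M X Y E₁ E₂ E₃ E₄ : List Color} (K : HBounds M X Y E₁ E₂ E₃ E₄) where
  open HBounds K

  hColouring-large-M : 7 ≤ card M → HColouring M X Y E₁ E₂ E₃ E₄
  hColouring-large-M kM′
    with c@(cycle {e₁} {e₂} {e₃} {e₄} _ _ _ _ _ _ _ _) ← cycle-colourable k₁ k₂ k₃ k₄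
    with x , x∈ , x≢e₁ ∷ x≢e₂ ∷ [] ← avoid X (e₁ ∷ e₂ ∷ []) kX
    with y , y∈ , y≢e₃ ∷ y≢e₄ ∷ y≢x ∷ [] ← avoid Y (e₃ ∷ e₄ ∷ x ∷ []) kY
    with m , m∈ , m≢e₁ ∷ m≢e₂ ∷ m≢e₃ ∷ m≢e₄ ∷ m≢x ∷ m≢y ∷ [] ← avoid M (e₁ ∷ e₂ ∷ e₃ ∷ e₄ ∷ x ∷ y ∷ []) kM′
    = hColouring c x∈ y∈ m∈ x≢e₁ x≢e₂ y≢e₃ y≢e₄ y≢x m≢e₁ m≢e₂ m≢e₃ m≢e₄ m≢x m≢y

  hColouring-large-X : 5 ≤ card X → HColouring M X Y E₁ E₂ E₃ E₄
  hColouring-large-X kX′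
    with c@(cycle {e₁} {e₂} {e₃} {e₄} _ _ _ _ _ _ _ _) ← cycle-colourable k₁ k₂ k₃ k₄
    with y , y∈ , y≢e₃ ∷ y≢e₄ ∷ [] ← avoid Y (e₃ ∷ e₄ ∷ []) kY
    with m , m∈ , m≢e₁ ∷ m≢e₂ ∷ m≢e₃ ∷ m≢e₄ ∷ m≢y ∷ [] ← avoid M (e₁ ∷ e₂ ∷ e₃ ∷ e₄ ∷ y ∷ []) kM
    with x , x∈ , x≢e₁ ∷ x≢e₂ ∷ x≢y ∷ x≢m ∷ [] ← avoid X (e₁ ∷ e₂ ∷ y ∷ m ∷ []) kX′
    = hColouring c x∈ y∈ m∈ x≢e₁ x≢e₂ y≢e₃ y≢e₄ (≢-sym x≢y) m≢e₁ m≢e₂ m≢e₃ m≢e₄ (≢-sym x≢m) m≢y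

  hColouring-E₁∩E₃ : {γ : Color} → γ ∈ E₁ → γ ∈ E₃ → HColouring M X Y E₁ E₂ E₃ E₄
  hColouring-E₁∩E₃ {γ} γ∈E₁ γ∈E₃
    with e₂ , e₂∈ , e₂≢γ ∷ [] ← avoid E₂ (γ ∷ []) k₂
    with e₄ , e₄∈ , e₄≢γ ∷ [] ← avoid E₄ (γ ∷ []) k₄
    with x , x∈ , x≢γ ∷ x≢e₂ ∷ [] ← avoid X (γ ∷ e₂ ∷ []) kX
    with y , y∈ , y≢γ ∷ y≢e₄ ∷ y≢x ∷ [] ← avoid Y (γ ∷ e₄ ∷ x ∷ []) kY
    with m , m∈ , m≢γ ∷ m≢e₂ ∷ m≢e₄ ∷ m≢x ∷ m≢y ∷ [] ← avoid M (γ ∷ e₂ ∷ e₄ ∷ x ∷ y ∷ []) kM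
    = hColouring (cycle γ∈E₁ e₂∈ γ∈E₃ e₄∈ (≢-sym e₂≢γ) e₂≢γ (≢-sym e₄≢γ) e₄≢γ)
        x∈ y∈ m∈ x≢γ x≢e₂ y≢γ y≢e₄ y≢x m≢γ m≢e₂ m≢γ m≢e₄ m≢x m≢y

  hColouring-X∩E₃ : Disjoint E₁ E₃ → Disjoint E₂ E₄ → {γ : Color} → γ ∈ X → γ ∈ E₃ →
    HColouring M X Y E₁ E₂ E₃ E₄
  hColouring-X∩E₃ E₁#E₃ E₂#E₄ {γ} γ∈X γ∈E₃
    with path {e₂} {e₁} {e₄} e₂∈ e₁∈ e₄∈ e₂≢e₁ e₁≢e₄ e₂≢γ e₄≢γ
           ← path-avoiding γ k₂ k₁ k₄ (Disjoint⇒∉⊎∉ γ E₂#E₄)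
    with y , y∈ , y≢γ ∷ y≢e₄ ∷ [] ← avoid Y (γ ∷ e₄ ∷ []) kY
    with m , m∈ , m≢γ ∷ m≢e₁ ∷ m≢e₂ ∷ m≢e₄ ∷ m≢y ∷ [] ← avoid M (γ ∷ e₁ ∷ e₂ ∷ e₄ ∷ y ∷ []) kM
    = hColouring (cycle e₁∈ e₂∈ γ∈E₃ e₄∈ (≢-sym e₂≢e₁) e₂≢γ (≢-sym e₄≢γ) (≢-sym e₁≢e₄))
        γ∈X y∈ m∈ (λ { refl → E₁#E₃ (e₁∈ , γ∈E₃) }) (≢-sym e₂≢γ) y≢γ y≢e₄ y≢γ m≢e₁ m≢e₂ m≢γ m≢e₄ m≢γ m≢y

  hColouring-E₁⊈M : Disjoint E₂ E₄ → {δ : Color} → δ ∈ E₁ → δ ∉ M → HColouring M X Y E₁ E₂ E₃ E₄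
  hColouring-E₁⊈M E₂#E₄ {δ} δ∈E₁ δ∉M
    with p@(path {e₂} {e₃} {e₄} _ _ _ _ _ _ _) ← path-avoiding δ k₂ k₃ k₄ (Disjoint⇒∉⊎∉ δ E₂#E₄)
    with x , x∈ , x≢δ ∷ x≢e₂ ∷ [] ← avoid X (δ ∷ e₂ ∷ []) kX
    with y , y∈ , y≢e₃ ∷ y≢e₄ ∷ y≢x ∷ [] ← avoid Y (e₃ ∷ e₄ ∷ x ∷ []) kY
    with m , m∈ , m≢e₂ ∷ m≢e₃ ∷ m≢e₄ ∷ m≢x ∷ m≢y ∷ [] ← avoid M (e₂ ∷ e₃ ∷ e₄ ∷ x ∷ y ∷ []) kM
    = hColouring (through δ∈E₁ p) x∈ y∈ m∈ x≢δ x≢e₂ y≢e₃ y≢e₄ y≢x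
        (∈∉⇒≢ m∈ δ∉M) m≢e₂ m≢e₃ m≢e₄ m≢x m≢y

  hColouring-X⊈M : E₁ ⊆ M → E₂ ⊆ M → {δ : Color} → δ ∈ X → δ ∉ M → HColouring M X Y E₁ E₂ E₃ E₄
  hColouring-X⊈M E₁⊆M E₂⊆M {δ} δ∈X δ∉M
    with c@(cycle {e₁} {e₂} {e₃} {e₄} e₁∈ e₂∈ _ _ _ _ _ _) ← cycle-colourable k₁ k₂ k₃ k₄
    with y , y∈ , y≢e₃ ∷ y≢e₄ ∷ y≢δ ∷ [] ← avoid Y (e₃ ∷ e₄ ∷ δ ∷ []) kY
    with m , m∈ , m≢e₁ ∷ m≢e₂ ∷ m≢e₃ ∷ m≢e₄ ∷ m≢y ∷ [] ← avoid M (e₁ ∷ e₂ ∷ e₃ ∷ e₄ ∷ y ∷ []) kM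
    = hColouring c δ∈X y∈ m∈ (≢-sym (∈∉⇒≢ (E₁⊆M e₁∈) δ∉M)) (≢-sym (∈∉⇒≢ (E₂⊆M e₂∈) δ∉M))
        y≢e₃ y≢e₄ y≢δ m≢e₁ m≢e₂ m≢e₃ m≢e₄ (∈∉⇒≢ m∈ δ∉M) m≢y

  obstruction : ¬ 7 ≤ card M → ¬ 5 ≤ card X → Disjoint X E₃ → Disjoint Y E₁ → Disjoint Y E₂ →
    E₁ ⊆ M → E₂ ⊆ M → E₃ ⊆ M → X ⊆ M → Y ⊆ M → Obstruction M X Y E₁ E₂ E₃ E₄
  obstruction ∣M∣≱7 ∣X∣≱5 X#E₃ Y#E₁ Y#E₂ E₁⊆M E₂⊆M E₃⊆M X⊆M Y⊆M = record
    { M⊆X∪E₃ = M⊆X∪E₃ ; X⊆M = X⊆M ; E₂⊆E₁ = E₂⊆E₁ ; ∣E₁∣≤2 = ∣E₁∣≤2 ; ∣X∣≤4 = ≤-pred (≰⇒> ∣X∣≱5) }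
    where
    ∣M∣≤6 : card M ≤ 6
    ∣M∣≤6 = ≤-pred (≰⇒> ∣M∣≱7)
    M⊆X∪E₃ : {c : Color} → c ∈ M → c ∈ X ⊎ c ∈ E₃
    M⊆X∪E₃ {c} c∈M with c ∈? X | c ∈? E₃
    ... | yes c∈X | _ = inj₁ c∈X
    ... | no _ | yes c∈E₃ = inj₂ c∈E₃
    ... | no c∉X | no c∉E₃ =
      ⊥-elim (<⇒≱ (≤-trans (s≤s (+-mono-≤ kX k₃)) (card-∷-disjoint c∉X c∉E₃ c∈M X#E₃ X⊆M E₃⊆M)) ∣M∣≤6)
    E₂⊆E₁ : E₂ ⊆ E₁
    E₂⊆E₁ {c} c∈E₂ = decidable-stable (c ∈? E₁) λ c∉E₁ →
      <⇒≱ (≤-trans (s≤s (+-mono-≤ kY k₁))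
        (card-∷-disjoint (λ c∈Y → Y#E₂ (c∈Y , c∈E₂)) c∉E₁ (E₂⊆M c∈E₂) Y#E₁ Y⊆M E₁⊆M)) ∣M∣≤6
    ∣E₁∣≤2 : card E₁ ≤ 2
    ∣E₁∣≤2 = +-cancelʳ-≤ 4 (card E₁) 2
      (≤-trans (+-monoʳ-≤ (card E₁) kY) (≤-trans (card-disjoint (Disjoint-sym Y#E₁) E₁⊆M Y⊆M) ∣M∣≤6))

hColouring-or-obstruction : {M X Y E₁ E₂ E₃ E₄ : List Color} → HBounds M X Y E₁ E₂ E₃ E₄ →
  HColouring M X Y E₁ E₂ E₃ E₄ ⊎ Obstruction M X Y E₁ E₂ E₃ E₄
hColouring-or-obstruction {M} {X} {Y} {E₁} {E₂} {E₃} {E₄} K with 7 ≤? card M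
... | yes kM′ = inj₁ (hColouring-large-M K kM′)
... | no ∣M∣≱7 with 5 ≤? card X
... | yes kX′ = inj₁ (hColouring-large-X K kX′)
... | no ∣X∣≱5 with 5 ≤? card Y
... | yes kY′ = inj₁ (hColouring-swap₂₄ (hColouring-large-X (hBounds-swap₂₄ K) kY′))
... | no _ with ∃∈⊎Disjoint E₁ E₃
... | inj₁ (_ , γ∈E₁ , γ∈E₃) = inj₁ (hColouring-E₁∩E₃ K γ∈E₁ γ∈E₃)
... | inj₂ E₁#E₃ with ∃∈⊎Disjoint E₂ E₄
... | inj₁ (_ , γ∈E₂ , γ∈E₄) = inj₁ (hColouring-swap₁₃ (hColouring-E₁∩E₃ (hBounds-swap₁₃ K) γ∈E₂ γ∈E₄))
... | inj₂ E₂#E₄ with ∃∈⊎Disjoint X E₃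
... | inj₁ (_ , γ∈X , γ∈E₃) = inj₁ (hColouring-X∩E₃ K E₁#E₃ E₂#E₄ γ∈X γ∈E₃)
... | inj₂ X#E₃ with ∃∈⊎Disjoint X E₄
... | inj₁ (_ , γ∈X , γ∈E₄) =
  inj₁ (hColouring-swap₁₃ (hColouring-X∩E₃ (hBounds-swap₁₃ K) E₂#E₄ E₁#E₃ γ∈X γ∈E₄))
... | inj₂ _ with ∃∈⊎Disjoint Y E₂
... | inj₁ (_ , γ∈Y , γ∈E₂) =
  inj₁ (hColouring-swap₂₄
    (hColouring-X∩E₃ (hBounds-swap₂₄ K) (Disjoint-sym E₂#E₄) (Disjoint-sym E₁#E₃) γ∈Y γ∈E₂))
... | inj₂ Y#E₂ with ∃∈⊎Disjoint Y E₁
... | inj₁ (_ , γ∈Y , γ∈E₁) = inj₁ (hColouring-swap₂₄ (hColouring-swap₁₃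
  (hColouring-X∩E₃ (hBounds-swap₁₃ (hBounds-swap₂₄ K)) (Disjoint-sym E₁#E₃) (Disjoint-sym E₂#E₄) γ∈Y γ∈E₁)))
... | inj₂ Y#E₁ with ∃∉⊎⊆ E₁ M
... | inj₁ (_ , δ∈E₁ , δ∉M) = inj₁ (hColouring-E₁⊈M K E₂#E₄ δ∈E₁ δ∉M)
... | inj₂ E₁⊆M with ∃∉⊎⊆ E₂ M
... | inj₁ (_ , δ∈E₂ , δ∉M) = inj₁ (hColouring-swap₁₃ (hColouring-E₁⊈M (hBounds-swap₁₃ K) E₁#E₃ δ∈E₂ δ∉M))
... | inj₂ E₂⊆M with ∃∉⊎⊆ E₄ M
... | inj₁ (_ , δ∈E₄ , δ∉M) =
  inj₁ (hColouring-swap₂₄ (hColouring-E₁⊈M (hBounds-swap₂₄ K) (Disjoint-sym E₁#E₃) δ∈E₄ δ∉M))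
... | inj₂ E₄⊆M with ∃∉⊎⊆ E₃ M
... | inj₁ (_ , δ∈E₃ , δ∉M) = inj₁ (hColouring-swap₂₄ (hColouring-swap₁₃
  (hColouring-E₁⊈M (hBounds-swap₁₃ (hBounds-swap₂₄ K)) (Disjoint-sym E₂#E₄) δ∈E₃ δ∉M)))
... | inj₂ E₃⊆M with ∃∉⊎⊆ X M
... | inj₁ (_ , δ∈X , δ∉M) = inj₁ (hColouring-X⊈M K E₁⊆M E₂⊆M δ∈X δ∉M)
... | inj₂ X⊆M with ∃∉⊎⊆ Y M
... | inj₁ (_ , δ∈Y , δ∉M) = inj₁ (hColouring-swap₂₄ (hColouring-X⊈M (hBounds-swap₂₄ K) E₄⊆M E₃⊆M δ∈Y δ∉M))
... | inj₂ Y⊆M = inj₂ (obstruction K ∣M∣≱7 ∣X∣≱5 X#E₃ Y#E₁ Y#E₂ E₁⊆M E₂⊆M E₃⊆M X⊆M Y⊆M)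

-- The triangle colouring t gives b = c₁ t to u₃v and a = c₂ t to u₃.
AfterTriangle : {A₁ A₂ A₃ : List Color} →
  (List Color → List Color → List Color → List Color → List Color → List Color → List Color → Set) →
  TriangleColouring A₁ A₂ A₃ → List Color → List Color → List Color → List Color → List Color →
  List Color → List Color → Set
AfterTriangle P t M X Y E₁ E₂ E₃ E₄ =
  P M (X ∖ (c₂ t ∷ [])) (Y ∖ (c₂ t ∷ [])) E₁ (E₂ ∖ (c₂ t ∷ c₁ t ∷ [])) (E₃ ∖ (c₂ t ∷ c₁ t ∷ [])) E₄

module _ (A₁ A₂ A₃ M X Y E₁ E₂ E₃ E₄ : List Color)
  (kM : 6 ≤ card M) (kX : 5 ≤ card X) (kY : 5 ≤ card Y)
  (k₁ : 2 ≤ card E₁) (k₂ : 4 ≤ card E₂) (k₃ : 4 ≤ card E₃) (k₄ : 2 ≤ card E₄) where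

  HColouringAfter ObstructionAfter : TriangleColouring A₁ A₂ A₃ → Set
  HColouringAfter t = AfterTriangle HColouring t M X Y E₁ E₂ E₃ E₄
  ObstructionAfter t = AfterTriangle Obstruction t M X Y E₁ E₂ E₃ E₄

  hColouring-or-obstruction-after : (t : TriangleColouring A₁ A₂ A₃) → HColouringAfter t ⊎ ObstructionAfter t
  hColouring-or-obstruction-after t = hColouring-or-obstruction (hBounds kM
    (≤-pred (≤-trans kX (card-∖ X (c₂ t ∷ [])))) (≤-pred (≤-trans kY (card-∖ Y (c₂ t ∷ [])))) k₁
    (≤-pred (≤-pred (≤-trans k₂ (card-∖ E₂ (c₂ t ∷ c₁ t ∷ [])))))
    (≤-pred (≤-pred (≤-trans k₃ (card-∖ E₃ (c₂ t ∷ c₁ t ∷ []))))) k₄)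

  module _ (t : TriangleColouring A₁ A₂ A₃) (O : ObstructionAfter t) where
    open Obstruction O

    obstruction⇒∉M : c₂ t ∉ M
    obstruction⇒∉M a∈M with M⊆X∪E₃ a∈M
    ... | inj₁ a∈X′ = proj₂ (∈-∖⁻ X _ a∈X′) (here refl)
    ... | inj₂ a∈E₃′ = proj₂ (∈-∖⁻ E₃ _ a∈E₃′) (here refl)

    obstruction⇒∈X : c₂ t ∈ X
    obstruction⇒∈X = decidable-stable (c₂ t ∈? X) λ a∉X → <⇒≱ (≤-trans kX (card-mono (X⊆X′ a∉X))) ∣X∣≤4
      where
      X⊆X′ : c₂ t ∉ X → X ⊆ X ∖ (c₂ t ∷ [])
      X⊆X′ a∉X c∈X = ∈-∖⁺ c∈X λ { (here refl) → a∉X c∈X }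

  -- An obstruction puts a outside M but inside X. If a ≢ a′ then a′ ∈ X ∖ {a} ⊆ M, a contradiction;
  -- if a ≡ a′ then b ≢ b′ and E₂ ⊆ {a} ∪ E₁ is too small.
  obstructions-clash : (t t′ : TriangleColouring A₁ A₂ A₃) → c₁ t ≢ c₁ t′ ⊎ c₂ t ≢ c₂ t′ →
    ObstructionAfter t → ObstructionAfter t′ → ⊥
  obstructions-clash t t′ differ O O′ with c₂ t ≟ c₂ t′ | differ
  ... | no a≢a′ | _ = obstruction⇒∉M t′ O′
    (Obstruction.X⊆M O (∈-∖⁺ (obstruction⇒∈X t′ O′) (All¬⇒¬Any (≢-sym a≢a′ ∷ []))))
  ... | yes a≡a′ | inj₂ a≢a′ = a≢a′ a≡a′
  ... | yes refl | inj₁ b≢b′ = <⇒≱ (≤-trans k₂ (≤-trans (card-mono E₂⊆a∷E₁) (card-∷ (c₂ t) E₁)))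
    (s≤s (Obstruction.∣E₁∣≤2 O))
    where
    E₂⊆a∷E₁ : E₂ ⊆ c₂ t ∷ E₁
    E₂⊆a∷E₁ {c} c∈E₂ with c ≟ c₂ t | c ≟ c₁ t
    ... | yes c≡a | _ = here c≡a
    ... | no c≢a | no c≢b = there (Obstruction.E₂⊆E₁ O (∈-∖⁺ c∈E₂ (All¬⇒¬Any (c≢a ∷ c≢b ∷ []))))
    ... | no c≢a | yes refl = there (Obstruction.E₂⊆E₁ O′ (∈-∖⁺ c∈E₂ (All¬⇒¬Any (c≢a ∷ b≢b′ ∷ []))))

  local-colouring : 2 ≤ card A₁ → 2 ≤ card A₂ → 2 ≤ card A₃ →
    (card A₁ ≡ 2 → card A₂ ≡ 2 → card A₃ ≡ 2 → ¬ (SameSet A₁ A₂ × SameSet A₂ A₃)) →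
    Σ[ t ∈ TriangleColouring A₁ A₂ A₃ ] HColouringAfter t
  local-colouring kA₁ kA₂ kA₃ not-all-equal
    with t , t′ , differ ← triangle-varying₁₂ kA₁ kA₂ kA₃ not-all-equal
    with hColouring-or-obstruction-after t | hColouring-or-obstruction-after t′
  ... | inj₁ h | _ = t , h
  ... | inj₂ _ | inj₁ h′ = t′ , h′
  ... | inj₂ O | inj₂ O′ = ⊥-elim (obstructions-clash t t′ differ O O′)

module _ (G : Graph) where

  Adj-sym : {x y : Fin (n G)} → Adj G x y → Adj G y x
  Adj-sym {x} {y} = subst T (Graph.sym G x y)

  Adj-irrefl : {x : Fin (n G)} → ¬ Adj G x x
  Adj-irrefl {x} = subst T (Graph.irrefl G x)

  Unique-neighbours⇒length≤deg : {u : Fin (n G)} {ys : List (Fin (n G))} →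
    Unique ys → (∀ {y} → y ∈ ys → Adj G u y) → length ys ≤ deg G u
  Unique-neighbours⇒length≤deg {u} ys! ys⊆N = Unique-⊆⇒length≤ _≟ᶠ_ ys!
    (λ y∈ys → ∈-filter⁺ (λ y → T? (adj G u y)) (∈-allFin _) (ys⊆N y∈ys))

  degree-3⇒≁ : {u p q r z : Fin (n G)} → deg G u ≡ 3 → Unique (p ∷ q ∷ r ∷ z ∷ []) →
    Adj G u p → Adj G u q → Adj G u r → ¬ Adj G u z
  degree-3⇒≁ {u} {p} {q} {r} {z} deg≡3 distinct up uq ur uz =
    <-irrefl refl (subst (4 ≤_) deg≡3 (Unique-neighbours⇒length≤deg distinct adjacent))
    where
    adjacent : ∀ {y} → y ∈ p ∷ q ∷ r ∷ z ∷ [] → Adj G u y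
    adjacent (here refl) = up
    adjacent (there (here refl)) = uq
    adjacent (there (there (here refl))) = ur
    adjacent (there (there (there (here refl)))) = uz

fill : Maybe Color → Color → Color
fill (just c) _ = c
fill nothing d = d

fill-just : {m : Maybe Color} {c d : Color} → m ≡ just c → fill m d ≡ c
fill-just refl = refl

just-≢ : {m₁ m₂ : Maybe Color} {c d : Color} → m₁ ≡ just c → m₂ ≡ just d → Differ m₁ m₂ → c ≢ d
just-≢ refl refl c≢d = c≢d

just-∈ : {m : Maybe Color} {A : List Color} {c : Color} → m ≡ just c → InList m A → c ∈ A
just-∈ refl c∈A = c∈A

module _ (G : Graph) (φ : PartialColoring G) where

  otherEdgeColours : Fin (n G) → Fin (n G) → List Color
  otherEdgeColours x y =
    concatMap (λ z → if adj G x z ∧ not (does (z ≟ᶠ y)) then toL (pe φ x z) else []) (allFin (n G))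

  ∈-forbV-pv : {x y : Fin (n G)} {d : Color} → Adj G x y → pv φ y ≡ just d → d ∈ forbV G φ x
  ∈-forbV-pv {x} {y} {d} xy pvy≡d = ∈-concatMap⁺ _ (lose (∈-allFin y) d∈)
    where
    d∈ : d ∈ (if adj G x y then toL (pv φ y) ++ toL (pe φ x y) else [])
    d∈ rewrite Equivalence.to T-≡ xy | pvy≡d = here refl

  ∈-forbV-pe : {x y : Fin (n G)} {d : Color} → Adj G x y → pe φ x y ≡ just d → d ∈ forbV G φ x
  ∈-forbV-pe {x} {y} {d} xy pexy≡d = ∈-concatMap⁺ _ (lose (∈-allFin y) d∈)
    where
    d∈ : d ∈ (if adj G x y then toL (pv φ y) ++ toL (pe φ x y) else [])
    d∈ rewrite Equivalence.to T-≡ xy | pexy≡d = ∈-++⁺ʳ (toL (pv φ y)) (here refl)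

  ∈-forbE-pv : {x y : Fin (n G)} {d : Color} → pv φ x ≡ just d → d ∈ forbE G φ x y
  ∈-forbE-pv pvx≡d rewrite pvx≡d = here refl

  ∈-forbE-pe : {x y z : Fin (n G)} {d : Color} → Adj G x z → z ≢ y → pe φ x z ≡ just d → d ∈ forbE G φ x y
  ∈-forbE-pe {x} {y} {z} {d} xz z≢y pexz≡d =
    ∈-++⁺ʳ (toL (pv φ x)) (∈-++⁺ʳ (toL (pv φ y)) (∈-++⁺ˡ (∈-concatMap⁺ _ (lose (∈-allFin z) d∈))))
    where
    d∈ : d ∈ (if adj G x z ∧ not (does (z ≟ᶠ y)) then toL (pe φ x z) else [])
    d∈ rewrite Equivalence.to T-≡ xz | dec-false (z ≟ᶠ y) z≢y | pexz≡d = here refl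

  forbE-sym : {x y : Fin (n G)} {c : Color} → c ∈ forbE G φ y x → c ∈ forbE G φ x y
  forbE-sym {x} {y} c∈ with ∈-++⁻ (toL (pv φ y)) c∈
  ... | inj₁ c∈y = ∈-++⁺ʳ (toL (pv φ x)) (∈-++⁺ˡ c∈y)
  ... | inj₂ c∈′ with ∈-++⁻ (toL (pv φ x)) c∈′
  ... | inj₁ c∈x = ∈-++⁺ˡ c∈x
  ... | inj₂ c∈″ with ∈-++⁻ (otherEdgeColours y x) c∈″
  ... | inj₁ c∈yz = ∈-++⁺ʳ (toL (pv φ x)) (∈-++⁺ʳ (toL (pv φ y)) (∈-++⁺ʳ (otherEdgeColours x y) c∈yz))
  ... | inj₂ c∈xz = ∈-++⁺ʳ (toL (pv φ x)) (∈-++⁺ʳ (toL (pv φ y)) (∈-++⁺ˡ c∈xz))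

record Completion (G : Graph) (L : ListAssignment G) (φ : PartialColoring G) : Set where
  field
    gv : Fin (n G) → Color
    ge : Fin (n G) → Fin (n G) → Color
    ge-sym : ∀ x y → ge x y ≡ ge y x
    gv-available : ∀ x → pv φ x ≡ nothing → gv x ∈ LavV G L φ x
    ge-available : ∀ x y → Adj G x y → pe φ x y ≡ nothing → ge x y ∈ LavE G L φ x y
    gv-proper : ∀ x y → Adj G x y → pv φ x ≡ nothing → pv φ y ≡ nothing → gv x ≢ gv y
    gv-ge-proper : ∀ x y → Adj G x y → pv φ x ≡ nothing → pe φ x y ≡ nothing → gv x ≢ ge x y
    ge-proper : ∀ x y z → Adj G x y → Adj G x z → y ≢ z →
      pe φ x y ≡ nothing → pe φ x z ≡ nothing → ge x y ≢ ge x z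

module _ (G : Graph) (L : ListAssignment G) (φ : PartialColoring G) where

  ∈-LavV⁻ : {x : Fin (n G)} {c : Color} → c ∈ LavV G L φ x → c ∈ Lv L x × c ∉ forbV G φ x
  ∈-LavV⁻ {x} = ∈-filter⁻ (_∉? forbV G φ x) {xs = Lv L x}

  ∈-LavE⁻ : {x y : Fin (n G)} {c : Color} → c ∈ LavE G L φ x y → c ∈ Le L x y × c ∉ forbE G φ x y
  ∈-LavE⁻ {x} {y} = ∈-filter⁻ (_∉? forbE G φ x y) {xs = Le L x y}

  LavE-sym : {x y : Fin (n G)} {c : Color} → c ∈ LavE G L φ x y → c ∈ LavE G L φ y x
  LavE-sym {x} {y} {c} c∈ = ∈-filter⁺ (_∉? forbE G φ y x) (subst (c ∈_) (Le-sym L x y) (proj₁ (∈-LavE⁻ c∈)))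
    (λ c∈forb → proj₂ (∈-LavE⁻ c∈) (forbE-sym G φ c∈forb))

  extend : IsPartialLTotal G L φ → Completion G L φ →
    Σ (TotalColoring G) (λ ψ → IsLTotal G L ψ × Extends G ψ φ)
  extend (inV , inE , properVV , properVE , properEE) C =
    ψ , (inV′ , inE′ , properVV′ , properVE′ , properEE′) , (λ _ _ → fill-just) , (λ _ _ _ _ → fill-just)
    where
    open Completion C
    ψ : TotalColoring G
    ψ = record { cv = λ x → fill (pv φ x) (gv x) ; ce = λ x y → fill (pe φ x y) (ge x y)
               ; ce-sym = λ x y → cong₂ fill (pe-sym φ x y) (ge-sym x y) }

    inV′ : ∀ x → fill (pv φ x) (gv x) ∈ Lv L x
    inV′ x with pv φ x in e
    ... | just _ = just-∈ e (inV x)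
    ... | nothing = proj₁ (∈-LavV⁻ (gv-available x e))

    inE′ : ∀ x y → Adj G x y → fill (pe φ x y) (ge x y) ∈ Le L x y
    inE′ x y xy with pe φ x y in e
    ... | just _ = just-∈ e (inE x y xy)
    ... | nothing = proj₁ (∈-LavE⁻ (ge-available x y xy e))

    properVV′ : ∀ x y → Adj G x y → fill (pv φ x) (gv x) ≢ fill (pv φ y) (gv y)
    properVV′ x y xy with pv φ x in ex | pv φ y in ey
    ... | just _ | just _ = just-≢ ex ey (properVV x y xy)
    ... | nothing | just _ = λ { refl → proj₂ (∈-LavV⁻ (gv-available x ex)) (∈-forbV-pv G φ xy ey) }
    ... | just _ | nothing =
      λ { refl → proj₂ (∈-LavV⁻ (gv-available y ey)) (∈-forbV-pv G φ (Adj-sym G xy) ex) }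
    ... | nothing | nothing = gv-proper x y xy ex ey

    properVE′ : ∀ x y → Adj G x y → fill (pv φ x) (gv x) ≢ fill (pe φ x y) (ge x y)
    properVE′ x y xy with pv φ x in ex | pe φ x y in ey
    ... | just _ | just _ = just-≢ ex ey (properVE x y xy)
    ... | nothing | just _ = λ { refl → proj₂ (∈-LavV⁻ (gv-available x ex)) (∈-forbV-pe G φ xy ey) }
    ... | just _ | nothing = λ { refl → proj₂ (∈-LavE⁻ (ge-available x y xy ey)) (∈-forbE-pv G φ {x} {y} ex) }
    ... | nothing | nothing = gv-ge-proper x y xy ex ey

    properEE′ : ∀ x y z → Adj G x y → Adj G x z → y ≢ z → fill (pe φ x y) (ge x y) ≢ fill (pe φ x z) (ge x z)
    properEE′ x y z xy xz y≢z with pe φ x y in ey | pe φ x z in ez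
    ... | just _ | just _ = just-≢ ey ez (properEE x y z xy xz y≢z)
    ... | nothing | just _ =
      λ { refl → proj₂ (∈-LavE⁻ (ge-available x y xy ey)) (∈-forbE-pe G φ {x} {y} xz (≢-sym y≢z) ez) }
    ... | just _ | nothing =
      λ { refl → proj₂ (∈-LavE⁻ (ge-available x z xz ez)) (∈-forbE-pe G φ {x} {z} xy y≢z ey) }
    ... | nothing | nothing = ge-proper x y z xy xz y≢z ey ez

data Place : Set where
  U₁ U₂ U₃ U₄ V : Place

data Free : Place → Set where
  free₂ : Free U₂
  free₃ : Free U₃
  free₄ : Free U₄
  freeᵥ : Free V

data Link : Place → Place → Set where
  l₁₂ : Link U₁ U₂
  l₂₁ : Link U₂ U₁
  l₂₃ : Link U₂ U₃
  l₃₂ : Link U₃ U₂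
  l₃₄ : Link U₃ U₄
  l₄₃ : Link U₄ U₃
  l₁₄ : Link U₁ U₄
  l₄₁ : Link U₄ U₁
  l₂₄ : Link U₂ U₄
  l₄₂ : Link U₄ U₂
  l₃ᵥ : Link U₃ V
  lᵥ₃ : Link V U₃

-- Unordered pairs of places are keyed by sums of distinct powers of two, which makes ge below symmetric.
key : Maybe Place → ℕ
key (just U₁) = 1
key (just U₂) = 2
key (just U₃) = 4
key (just U₄) = 8
key (just V) = 16
key nothing = 0

module Configuration
  (G : Graph) (L : ListAssignment G) (u₁ u₂ u₃ u₄ v : Fin (n G))
  (u₁≢u₂ : u₁ ≢ u₂) (u₁≢u₃ : u₁ ≢ u₃) (u₁≢u₄ : u₁ ≢ u₄) (u₂≢u₃ : u₂ ≢ u₃) (u₂≢u₄ : u₂ ≢ u₄) (u₃≢u₄ : u₃ ≢ u₄)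
  (v≢u₁ : v ≢ u₁) (v≢u₂ : v ≢ u₂) (v≢u₄ : v ≢ u₄)
  (u₁u₂ : Adj G u₁ u₂) (u₂u₃ : Adj G u₂ u₃) (u₃u₄ : Adj G u₃ u₄) (u₄u₁ : Adj G u₄ u₁) (u₂u₄ : Adj G u₂ u₄)
  (deg-u₂ : deg G u₂ ≡ 3) (deg-u₄ : deg G u₄ ≡ 3) (u₃v : Adj G u₃ v)
  (φ : PartialColoring G)
  (uncoloured-vertex : ∀ x → pv φ x ≡ nothing → x ≡ u₂ ⊎ x ≡ u₃ ⊎ x ≡ u₄ ⊎ x ≡ v)
  (uncoloured-edge : ∀ x y → Adj G x y → pe φ x y ≡ nothing →
    SameEdge x y u₁ u₂ ⊎ SameEdge x y u₂ u₃ ⊎ SameEdge x y u₃ u₄ ⊎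
    SameEdge x y u₁ u₄ ⊎ SameEdge x y u₂ u₄ ⊎ SameEdge x y u₃ v)
  (t : TriangleColouring (LavE G L φ u₃ v) (LavV G L φ u₃) (LavV G L φ v))
  (h : AfterTriangle HColouring t (LavE G L φ u₂ u₄) (LavV G L φ u₂) (LavV G L φ u₄)
         (LavE G L φ u₁ u₂) (LavE G L φ u₂ u₃) (LavE G L φ u₃ u₄) (LavE G L φ u₁ u₄))
  where

  open TriangleColouring t renaming (c₁ to b; c₂ to a; c₃ to w)
  open HColouring h
  open CycleColouring cyc using (e₁∈; e₂∈; e₃∈; e₄∈; e₁≢e₂; e₂≢e₃; e₃≢e₄; e₄≢e₁)

  ι : Place → Fin (n G)
  ι U₁ = u₁
  ι U₂ = u₂
  ι U₃ = u₃
  ι U₄ = u₄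
  ι V = v

  place : Fin (n G) → Maybe Place
  place x =
    if does (x ≟ᶠ u₁) then just U₁ else
    if does (x ≟ᶠ u₂) then just U₂ else
    if does (x ≟ᶠ u₃) then just U₃ else
    if does (x ≟ᶠ u₄) then just U₄ else
    if does (x ≟ᶠ v) then just V else nothing

  v≢u₃ : v ≢ u₃
  v≢u₃ refl = Adj-irrefl G u₃v

  place-ι : ∀ p → place (ι p) ≡ just p
  place-ι U₁ rewrite dec-true (u₁ ≟ᶠ u₁) refl = refl
  place-ι U₂ rewrite dec-false (u₂ ≟ᶠ u₁) (≢-sym u₁≢u₂) | dec-true (u₂ ≟ᶠ u₂) refl = refl
  place-ι U₃ rewrite dec-false (u₃ ≟ᶠ u₁) (≢-sym u₁≢u₃) | dec-false (u₃ ≟ᶠ u₂) (≢-sym u₂≢u₃)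
    | dec-true (u₃ ≟ᶠ u₃) refl = refl
  place-ι U₄ rewrite dec-false (u₄ ≟ᶠ u₁) (≢-sym u₁≢u₄) | dec-false (u₄ ≟ᶠ u₂) (≢-sym u₂≢u₄)
    | dec-false (u₄ ≟ᶠ u₃) (≢-sym u₃≢u₄) | dec-true (u₄ ≟ᶠ u₄) refl = refl
  place-ι V rewrite dec-false (v ≟ᶠ u₁) v≢u₁ | dec-false (v ≟ᶠ u₂) v≢u₂ | dec-false (v ≟ᶠ u₃) v≢u₃
    | dec-false (v ≟ᶠ u₄) v≢u₄ | dec-true (v ≟ᶠ v) refl = refl

  ι-injective : ∀ {p q} → ι p ≡ ι q → p ≡ q
  ι-injective {p} {q} ιp≡ιq = just-injective (trans (sym (place-ι p)) (trans (cong place ιp≡ιq) (place-ι q)))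

  x∈Lav : x ∈ LavV G L φ u₂
  x∈Lav = proj₁ (∈-∖⁻ (LavV G L φ u₂) _ x∈)

  y∈Lav : y ∈ LavV G L φ u₄
  y∈Lav = proj₁ (∈-∖⁻ (LavV G L φ u₄) _ y∈)

  e₂∈Lav : e₂ cyc ∈ LavE G L φ u₂ u₃
  e₂∈Lav = proj₁ (∈-∖⁻ (LavE G L φ u₂ u₃) _ e₂∈)

  e₃∈Lav : e₃ cyc ∈ LavE G L φ u₃ u₄
  e₃∈Lav = proj₁ (∈-∖⁻ (LavE G L φ u₃ u₄) _ e₃∈)

  x≢a : x ≢ a
  x≢a refl = proj₂ (∈-∖⁻ (LavV G L φ u₂) _ x∈) (here refl)

  y≢a : y ≢ a
  y≢a refl = proj₂ (∈-∖⁻ (LavV G L φ u₄) _ y∈) (here refl)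

  e₂≢a : e₂ cyc ≢ a
  e₂≢a refl = proj₂ (∈-∖⁻ (LavE G L φ u₂ u₃) _ e₂∈) (here refl)

  e₂≢b : e₂ cyc ≢ b
  e₂≢b refl = proj₂ (∈-∖⁻ (LavE G L φ u₂ u₃) _ e₂∈) (there (here refl))

  e₃≢a : e₃ cyc ≢ a
  e₃≢a refl = proj₂ (∈-∖⁻ (LavE G L φ u₃ u₄) _ e₃∈) (here refl)

  e₃≢b : e₃ cyc ≢ b
  e₃≢b refl = proj₂ (∈-∖⁻ (LavE G L φ u₃ u₄) _ e₃∈) (there (here refl))

  vertexColour : Place → Color
  vertexColour U₁ = 0  -- u₁ is coloured by φ, so this value is never read
  vertexColour U₂ = x
  vertexColour U₃ = a
  vertexColour U₄ = y
  vertexColour V = w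

  edgeColour : ℕ → Color
  edgeColour 3 = e₁ cyc
  edgeColour 6 = e₂ cyc
  edgeColour 12 = e₃ cyc
  edgeColour 9 = e₄ cyc
  edgeColour 10 = m
  edgeColour 20 = b
  edgeColour _ = 0

  linkColour : Place → Place → Color
  linkColour p q = edgeColour (key (just p) + key (just q))

  u₂≁v : ¬ Adj G u₂ v
  u₂≁v = degree-3⇒≁ G deg-u₂
    ((u₁≢u₃ ∷ u₁≢u₄ ∷ ≢-sym v≢u₁ ∷ []) ∷ (u₃≢u₄ ∷ ≢-sym v≢u₃ ∷ []) ∷ (≢-sym v≢u₄ ∷ []) ∷ [] ∷ [])
    (Adj-sym G u₁u₂) u₂u₃ u₂u₄

  u₄≁v : ¬ Adj G u₄ v
  u₄≁v = degree-3⇒≁ G deg-u₄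
    ((u₁≢u₂ ∷ u₁≢u₃ ∷ ≢-sym v≢u₁ ∷ []) ∷ (u₂≢u₃ ∷ ≢-sym v≢u₂ ∷ []) ∷ (≢-sym v≢u₃ ∷ []) ∷ [] ∷ [])
    u₄u₁ (Adj-sym G u₂u₄) (Adj-sym G u₃u₄)

  vertex-available : ∀ {p} → Free p → vertexColour p ∈ LavV G L φ (ι p)
  vertex-available free₂ = x∈Lav
  vertex-available free₃ = c₂∈
  vertex-available free₄ = y∈Lav
  vertex-available freeᵥ = c₃∈

  link-available : ∀ {p q} → Link p q → linkColour p q ∈ LavE G L φ (ι p) (ι q)
  link-available l₁₂ = e₁∈
  link-available l₂₁ = LavE-sym G L φ e₁∈
  link-available l₂₃ = e₂∈Lav
  link-available l₃₂ = LavE-sym G L φ e₂∈Lav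
  link-available l₃₄ = e₃∈Lav
  link-available l₄₃ = LavE-sym G L φ e₃∈Lav
  link-available l₁₄ = e₄∈
  link-available l₄₁ = LavE-sym G L φ e₄∈
  link-available l₂₄ = m∈
  link-available l₄₂ = LavE-sym G L φ m∈
  link-available l₃ᵥ = c₁∈
  link-available lᵥ₃ = LavE-sym G L φ c₁∈

  vertex-proper : ∀ {p q} → Free p → Free q → Adj G (ι p) (ι q) → vertexColour p ≢ vertexColour q
  vertex-proper free₂ free₂ u₂u₂ = ⊥-elim (Adj-irrefl G u₂u₂)
  vertex-proper free₂ free₃ _ = x≢a
  vertex-proper free₂ free₄ _ = ≢-sym y≢x
  vertex-proper free₂ freeᵥ u₂v = ⊥-elim (u₂≁v u₂v)
  vertex-proper free₃ free₂ _ = ≢-sym x≢a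
  vertex-proper free₃ free₃ u₃u₃ = ⊥-elim (Adj-irrefl G u₃u₃)
  vertex-proper free₃ free₄ _ = ≢-sym y≢a
  vertex-proper free₃ freeᵥ _ = c₂≢c₃
  vertex-proper free₄ free₂ _ = y≢x
  vertex-proper free₄ free₃ _ = y≢a
  vertex-proper free₄ free₄ u₄u₄ = ⊥-elim (Adj-irrefl G u₄u₄)
  vertex-proper free₄ freeᵥ u₄v = ⊥-elim (u₄≁v u₄v)
  vertex-proper freeᵥ free₂ vu₂ = ⊥-elim (u₂≁v (Adj-sym G vu₂))
  vertex-proper freeᵥ free₃ _ = ≢-sym c₂≢c₃
  vertex-proper freeᵥ free₄ vu₄ = ⊥-elim (u₄≁v (Adj-sym G vu₄))
  vertex-proper freeᵥ freeᵥ vv = ⊥-elim (Adj-irrefl G vv)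

  vertex-link-proper : ∀ {p q} → Free p → Link p q → vertexColour p ≢ linkColour p q
  vertex-link-proper free₂ l₂₁ = x≢e₁
  vertex-link-proper free₂ l₂₃ = x≢e₂
  vertex-link-proper free₂ l₂₄ = ≢-sym m≢x
  vertex-link-proper free₃ l₃₂ = ≢-sym e₂≢a
  vertex-link-proper free₃ l₃₄ = ≢-sym e₃≢a
  vertex-link-proper free₃ l₃ᵥ = ≢-sym c₁≢c₂
  vertex-link-proper free₄ l₄₃ = y≢e₃
  vertex-link-proper free₄ l₄₁ = y≢e₄
  vertex-link-proper free₄ l₄₂ = ≢-sym m≢y
  vertex-link-proper freeᵥ lᵥ₃ = ≢-sym c₁≢c₃

  link-proper : ∀ {p q r} → Link p q → Link p r → q ≢ r → linkColour p q ≢ linkColour p r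
  link-proper l₁₂ l₁₂ q≢r = ⊥-elim (q≢r refl)
  link-proper l₁₂ l₁₄ _ = ≢-sym e₄≢e₁
  link-proper l₁₄ l₁₂ _ = e₄≢e₁
  link-proper l₁₄ l₁₄ q≢r = ⊥-elim (q≢r refl)
  link-proper l₂₁ l₂₁ q≢r = ⊥-elim (q≢r refl)
  link-proper l₂₁ l₂₃ _ = e₁≢e₂
  link-proper l₂₁ l₂₄ _ = ≢-sym m≢e₁
  link-proper l₂₃ l₂₁ _ = ≢-sym e₁≢e₂
  link-proper l₂₃ l₂₃ q≢r = ⊥-elim (q≢r refl)
  link-proper l₂₃ l₂₄ _ = ≢-sym m≢e₂
  link-proper l₂₄ l₂₁ _ = m≢e₁
  link-proper l₂₄ l₂₃ _ = m≢e₂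
  link-proper l₂₄ l₂₄ q≢r = ⊥-elim (q≢r refl)
  link-proper l₃₂ l₃₂ q≢r = ⊥-elim (q≢r refl)
  link-proper l₃₂ l₃₄ _ = e₂≢e₃
  link-proper l₃₂ l₃ᵥ _ = e₂≢b
  link-proper l₃₄ l₃₂ _ = ≢-sym e₂≢e₃
  link-proper l₃₄ l₃₄ q≢r = ⊥-elim (q≢r refl)
  link-proper l₃₄ l₃ᵥ _ = e₃≢b
  link-proper l₃ᵥ l₃₂ _ = ≢-sym e₂≢b
  link-proper l₃ᵥ l₃₄ _ = ≢-sym e₃≢b
  link-proper l₃ᵥ l₃ᵥ q≢r = ⊥-elim (q≢r refl)
  link-proper l₄₃ l₄₃ q≢r = ⊥-elim (q≢r refl)
  link-proper l₄₃ l₄₁ _ = e₃≢e₄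
  link-proper l₄₃ l₄₂ _ = ≢-sym m≢e₃
  link-proper l₄₁ l₄₃ _ = ≢-sym e₃≢e₄
  link-proper l₄₁ l₄₁ q≢r = ⊥-elim (q≢r refl)
  link-proper l₄₁ l₄₂ _ = ≢-sym m≢e₄
  link-proper l₄₂ l₄₃ _ = m≢e₃
  link-proper l₄₂ l₄₁ _ = m≢e₄
  link-proper l₄₂ l₄₂ q≢r = ⊥-elim (q≢r refl)
  link-proper lᵥ₃ lᵥ₃ q≢r = ⊥-elim (q≢r refl)

  UncolouredEdge : Fin (n G) → Fin (n G) → Set
  UncolouredEdge x y = Σ[ p ∈ Place ] Σ[ q ∈ Place ] Link p q × x ≡ ι p × y ≡ ι q

  oriented : ∀ {p q x y} → Link p q → Link q p → SameEdge x y (ι p) (ι q) → UncolouredEdge x y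
  oriented l _ (inj₁ (x≡ , y≡)) = _ , _ , l , x≡ , y≡
  oriented _ l′ (inj₂ (x≡ , y≡)) = _ , _ , l′ , x≡ , y≡

  classify-edge : ∀ x y → Adj G x y → pe φ x y ≡ nothing → UncolouredEdge x y
  classify-edge x y xy e with uncoloured-edge x y xy e
  ... | inj₁ s = oriented l₁₂ l₂₁ s
  ... | inj₂ (inj₁ s) = oriented l₂₃ l₃₂ s
  ... | inj₂ (inj₂ (inj₁ s)) = oriented l₃₄ l₄₃ s
  ... | inj₂ (inj₂ (inj₂ (inj₁ s))) = oriented l₁₄ l₄₁ s
  ... | inj₂ (inj₂ (inj₂ (inj₂ (inj₁ s)))) = oriented l₂₄ l₄₂ s
  ... | inj₂ (inj₂ (inj₂ (inj₂ (inj₂ s)))) = oriented l₃ᵥ lᵥ₃ s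

  classify-vertex : ∀ x → pv φ x ≡ nothing → Σ[ p ∈ Place ] Free p × x ≡ ι p
  classify-vertex x e with uncoloured-vertex x e
  ... | inj₁ x≡ = U₂ , free₂ , x≡
  ... | inj₂ (inj₁ x≡) = U₃ , free₃ , x≡
  ... | inj₂ (inj₂ (inj₁ x≡)) = U₄ , free₄ , x≡
  ... | inj₂ (inj₂ (inj₂ x≡)) = V , freeᵥ , x≡

  gv : Fin (n G) → Color
  gv x = maybe vertexColour 0 (place x)

  ge : Fin (n G) → Fin (n G) → Color
  ge x y = edgeColour (key (place x) + key (place y))

  gv-ι : ∀ p → gv (ι p) ≡ vertexColour p
  gv-ι p rewrite place-ι p = refl

  ge-ι : ∀ p q → ge (ι p) (ι q) ≡ linkColour p q
  ge-ι p q rewrite place-ι p | place-ι q = refl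

  completion : Completion G L φ
  completion = record
    { gv = gv
    ; ge = ge
    ; ge-sym = λ x y → cong edgeColour (+-comm (key (place x)) (key (place y)))
    ; gv-available = gv-available
    ; ge-available = ge-available
    ; gv-proper = gv-proper
    ; gv-ge-proper = gv-ge-proper
    ; ge-proper = ge-proper
    }
    where
    gv-available : ∀ x → pv φ x ≡ nothing → gv x ∈ LavV G L φ x
    gv-available x e with classify-vertex x e
    ... | p , f , refl rewrite gv-ι p = vertex-available f

    ge-available : ∀ x y → Adj G x y → pe φ x y ≡ nothing → ge x y ∈ LavE G L φ x y
    ge-available x y xy e with classify-edge x y xy e
    ... | p , q , l , refl , refl rewrite ge-ι p q = link-available l

    gv-proper : ∀ x y → Adj G x y → pv φ x ≡ nothing → pv φ y ≡ nothing → gv x ≢ gv y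
    gv-proper x y xy ex ey with classify-vertex x ex | classify-vertex y ey
    ... | p , f , refl | q , f′ , refl rewrite gv-ι p | gv-ι q = vertex-proper f f′ xy

    gv-ge-proper : ∀ x y → Adj G x y → pv φ x ≡ nothing → pe φ x y ≡ nothing → gv x ≢ ge x y
    gv-ge-proper x y xy ex ey with classify-vertex x ex | classify-edge x y xy ey
    ... | p , f , refl | p′ , q , l , ιp≡ιp′ , refl with refl ← ι-injective ιp≡ιp′
      rewrite gv-ι p | ge-ι p q = vertex-link-proper f l

    ge-proper : ∀ x y z → Adj G x y → Adj G x z → y ≢ z →
      pe φ x y ≡ nothing → pe φ x z ≡ nothing → ge x y ≢ ge x z
    ge-proper x y z xy xz y≢z ey ez with classify-edge x y xy ey | classify-edge x z xz ez
    ... | p , q , l , refl , refl | p′ , r , l′ , ιp≡ιp′ , refl with refl ← ι-injective ιp≡ιp′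
      rewrite ge-ι p q | ge-ι p r = link-proper l l′ λ { refl → y≢z refl }

lemma3p4 : (G : Graph) (L : ListAssignment G) (u₁ u₂ u₃ u₄ v : Fin (n G)) →
    u₁ ≢ u₂ → u₁ ≢ u₃ → u₁ ≢ u₄ → u₂ ≢ u₃ → u₂ ≢ u₄ → u₃ ≢ u₄ →
    v ≢ u₁ → v ≢ u₂ → v ≢ u₄ →
    Adj G u₁ u₂ → Adj G u₂ u₃ → Adj G u₃ u₄ → Adj G u₄ u₁ → Adj G u₂ u₄ →
    deg G u₂ ≡ 3 → deg G u₄ ≡ 3 → Adj G u₃ v →
    (φ' : PartialColoring G) → IsPartialLTotal G L φ' →
    (∀ x → (pv φ' x ≡ nothing) ⇔' (x ≡ u₂ ⊎ x ≡ u₃ ⊎ x ≡ u₄ ⊎ x ≡ v)) →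
    (∀ x y → Adj G x y →
      (pe φ' x y ≡ nothing) ⇔'
      (SameEdge x y u₁ u₂ ⊎ SameEdge x y u₂ u₃ ⊎ SameEdge x y u₃ u₄ ⊎
       SameEdge x y u₁ u₄ ⊎ SameEdge x y u₂ u₄ ⊎ SameEdge x y u₃ v)) →
    card (LavE G L φ' u₂ u₄) ≥ 6 →
    card (LavV G L φ' u₂) ≥ 5 → card (LavV G L φ' u₄) ≥ 5 →
    card (LavE G L φ' u₂ u₃) ≥ 4 → card (LavE G L φ' u₃ u₄) ≥ 4 →
    card (LavE G L φ' u₁ u₂) ≥ 2 → card (LavE G L φ' u₁ u₄) ≥ 2 →
    card (LavE G L φ' u₃ v) ≥ 2 → card (LavV G L φ' u₃) ≥ 2 →
    card (LavV G L φ' v) ≥ 2 →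
    (card (LavE G L φ' u₃ v) ≡ 2 → card (LavV G L φ' u₃) ≡ 2 → card (LavV G L φ' v) ≡ 2 →
      ¬ (SameSet (LavE G L φ' u₃ v) (LavV G L φ' u₃) ×
         SameSet (LavV G L φ' u₃) (LavV G L φ' v))) →
    Σ (TotalColoring G) (λ φ → IsLTotal G L φ × Extends G φ φ')
lemma3p4 G L u₁ u₂ u₃ u₄ v u₁≢u₂ u₁≢u₃ u₁≢u₄ u₂≢u₃ u₂≢u₄ u₃≢u₄ v≢u₁ v≢u₂ v≢u₄
  u₁u₂ u₂u₃ u₃u₄ u₄u₁ u₂u₄ deg-u₂ deg-u₄ u₃v φ′ φ′-partial uncoloured-vertices uncoloured-edges
  k-u₂u₄ k-u₂ k-u₄ k-u₂u₃ k-u₃u₄ k-u₁u₂ k-u₁u₄ k-u₃v k-u₃ k-v not-all-equal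
  = extend G L φ′ φ′-partial (uncurry (Configuration.completion G L u₁ u₂ u₃ u₄ v
      u₁≢u₂ u₁≢u₃ u₁≢u₄ u₂≢u₃ u₂≢u₄ u₃≢u₄ v≢u₁ v≢u₂ v≢u₄ u₁u₂ u₂u₃ u₃u₄ u₄u₁ u₂u₄ deg-u₂ deg-u₄ u₃v φ′
      (λ x → proj₁ (uncoloured-vertices x)) (λ x y xy → proj₁ (uncoloured-edges x y xy)))
    (local-colouring (Le′ u₃ v) (Lv′ u₃) (Lv′ v) (Le′ u₂ u₄) (Lv′ u₂) (Lv′ u₄)
      (Le′ u₁ u₂) (Le′ u₂ u₃) (Le′ u₃ u₄) (Le′ u₁ u₄)
      k-u₂u₄ k-u₂ k-u₄ k-u₁u₂ k-u₂u₃ k-u₃u₄ k-u₁u₄ k-u₃v k-u₃ k-v not-all-equal))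
  where
  Lv′ : Fin (n G) → List Color
  Lv′ = LavV G L φ′
  Le′ : Fin (n G) → Fin (n G) → List Color
  Le′ = LavE G L φ′
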